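{- Every hypertree $T$ with $m(T)\equiv 0\pmod 3$ has a helpful configuration.
   Context: A hypergraph $T=(V,E)$ has a finite vertex set and edges that are subsets of size at least $2$; $m(T)=|E|$; $d(v)$ is the number of edges containing $v$; two vertices are adjacent if they lie in a common edge. A hypertree is a hypergraph whose incidence graph (bipartite graph on $V\cup E$, $v\sim e$ iff $v\in e$) is a tree; components are taken in the incidence graph. For a vertex $w$, $T-w$ is the hypergraph obtained by deleting $w$ and all edges containing $w$. A leaf-edge is an edge containing at most one vertex of degree greater than $1$; a leaf is a vertex of degree one contained in a leaf-edge. A set $\{u\}$ is a helpful $1$-configuration if $d(u)\equiv 0\pmod 3$. A set $A=\{u_1,u_2\}$ is a helpful $2$-set if $u_1$ and $u_2$ are non-adjacent, $d(u_2)\equiv 2\pmod 3$ and $u_1$ is a leaf. For such $A$, let $P_T(A)$ be the set of edges belonging to those components of $T-u_2$ that do not contain $u_1$; $A$ is a helpful $2$-configuration if $|P_T(A)|\equiv 0\pmod 3$. A helpful configuration is a set that is a helpful $1$-configuration or a helpful $2$-configuration. -}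

module Defs where

open import Data.Nat using (ℕ; _≤_; _<_)
open import Data.Nat.DivMod using (_%_)
open import Data.Fin using (Fin)
open import Data.Fin.Subset using (Subset; _∈_; _∉_; ∣_∣)
open import Data.Vec using (tabulate; lookup)
open import Data.List using (List; []; _∷_; _++_; [_]; length)
open import Data.List.Relation.Unary.Linked using (Linked)
open import Data.List.Relation.Unary.Unique.Propositional using (Unique)
open import Data.Sum using (_⊎_; inj₁; inj₂)
open import Data.Product using (Σ; ∃; ∃-syntax; _×_; _,_)
open import Data.Empty using (⊥)
open import Relation.Nullary using (¬_)
open import Relation.Binary.PropositionalEquality using (_≡_; _≢_)
open import Relation.Binary.Construct.Closure.ReflexiveTransitive using (Star)
open import Function.Bundles using (_⇔_)

record Hypergraph : Set where
  field
    n         : ℕ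
    m         : ℕ
    edge      : Fin m → Subset n
    edge-size : ∀ e → 2 ≤ ∣ edge e ∣

module _ (T : Hypergraph) where
  open Hypergraph T

  d : Fin n → ℕ
  d v = ∣ tabulate (λ e → lookup (edge e) v) ∣

  Adjacent : Fin n → Fin n → Set
  Adjacent u v = ∃[ e ] (u ∈ edge e × v ∈ edge e)

  -- nodes of the incidence graph
  Node : Set
  Node = Fin n ⊎ Fin m

  data _~_ : Node → Node → Set where
    ve : ∀ {v e} → v ∈ edge e → inj₁ v ~ inj₂ e
    ev : ∀ {v e} → v ∈ edge e → inj₂ e ~ inj₁ v

  Connected : Set
  Connected = ∀ x y → Star _~_ x y

  HasCycle : Set
  HasCycle = Σ Node λ x → Σ (List Node) λ ys → Σ Node λ z →
    Linked _~_ (x ∷ ys ++ [ z ]) × Unique (x ∷ ys ++ [ z ]) ×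
    1 ≤ length ys × z ~ x

  IsHypertree : Set
  IsHypertree = 1 ≤ n × Connected × ¬ HasCycle

  LeafEdge : Fin m → Set
  LeafEdge e = ∀ x y → x ∈ edge e → y ∈ edge e → 1 < d x → 1 < d y → x ≡ y

  Leaf : Fin n → Set
  Leaf u = d u ≡ 1 × ∃[ e ] (u ∈ edge e × LeafEdge e)

  -- nodes surviving in T - w (w deleted, and all edges containing w deleted)
  Alive : Fin n → Node → Set
  Alive w (inj₁ v) = v ≢ w
  Alive w (inj₂ e) = w ∉ edge e

  data Step (w : Fin n) : Node → Node → Set where
    step : ∀ {x y} → Alive w x → Alive w y → x ~ y → Step w x y

  SameComponent : Fin n → Node → Node → Set
  SameComponent w x y = Star (Step w) x y

  -- e ∈ P_T({u1,u2}): e is an edge of T - u2 whose component in T - u2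
  -- does not contain u1
  InP : Fin n → Fin n → Fin m → Set
  InP u₁ u₂ e = u₂ ∉ edge e × ¬ SameComponent u₂ (inj₁ u₁) (inj₂ e)

  Helpful1 : Fin n → Set
  Helpful1 u = d u % 3 ≡ 0

  Helpful2Set : Fin n → Fin n → Set
  Helpful2Set u₁ u₂ = ¬ Adjacent u₁ u₂ × d u₂ % 3 ≡ 2 × Leaf u₁

  -- |P_T(A)| ≡ 0 mod 3, with P_T(A) given as a subset of the edges
  Helpful2 : Fin n → Fin n → Set
  Helpful2 u₁ u₂ = Helpful2Set u₁ u₂ ×
    Σ (Subset m) λ P → (∀ e → (e ∈ P) ⇔ InP u₁ u₂ e) × ∣ P ∣ % 3 ≡ 0

  HasHelpfulConfiguration : Set
  HasHelpfulConfiguration = (∃[ u ] Helpful1 u) ⊎ (∃[ u₁ ] ∃[ u₂ ] Helpful2 u₁ u₂)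

module Submission where

open import Defs
open import Level using (0ℓ)
open import Data.Bool using (Bool; true; false; if_then_else_)
open import Data.Nat using (ℕ; zero; suc; _+_; _*_; _≤_; _<_; z≤n; s≤s; _<?_) renaming (_≟_ to _≟ℕ_)
open import Data.Nat.Properties
  using (+-*-semiring; +-comm; +-assoc; +-identityʳ; m≤m+n; n≤1+n; n<1+n; <⇒≱; ≮⇒≥; n≤0⇒n≡0;
         ≤-refl; ≤-trans; <-trans; <-≤-trans; <-irrefl; module ≤-Reasoning)
open import Data.Nat.DivMod using (_%_; %-distribˡ-+; m%n<n; [m+n]%n≡m%n; [m+kn]%n≡m%n)
open import Data.Nat.Tactic.RingSolver using (solve-∀)
open import Data.Fin using (Fin; zero; suc; punchIn; fromℕ<)
open import Data.Fin.Properties using (punchInᵢ≢i; any?; injective⇒≤; +↔⊎) renaming (_≟_ to _≟ᶠ_)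
open import Data.Fin.Subset using (Subset; inside; outside; _∈_; _∉_; ∣_∣; ⁅_⁆)
open import Data.Fin.Subset.Properties using (_∈?_; p⊆q⇒∣p∣≤∣q∣; ∣⁅x⁆∣≡1; x∈⁅x⁆)
open import Data.Vec using ([]; _∷_; tabulate; lookup)
open import Data.Vec.Properties using (lookup∘tabulate; []=⇒lookup; lookup⇒[]=)
open import Data.List as List using (List; []; _∷_; _++_; [_]; length; initLast; _∷ʳ′_)
open import Data.List.Relation.Unary.Linked using (Linked; [-]; _∷_)
open import Data.List.Relation.Unary.All as All using (All; []; _∷_)
open import Data.List.Relation.Unary.Unique.Propositional using (Unique; []; _∷_)
open import Data.List.Relation.Unary.Any using (here; there)
open import Data.List.Membership.Propositional using () renaming (_∈_ to _∈ₗ_)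
open import Data.List.Membership.Propositional.Properties using (∈-lookup)
open import Data.Product using (∃; _×_; _,_; proj₁; proj₂)
open import Data.Sum using (_⊎_; inj₁; inj₂)
import Data.Sum.Properties as Sum
open import Data.Unit using (tt)
open import Data.Empty using (⊥; ⊥-elim)
open import Function using (id; _∘_; _↔_; Inverse)
open import Function.Bundles using (_⇔_; mk⇔; Equivalence)
open import Relation.Unary using (_∩_)
open import Relation.Nullary using (¬_; Dec; yes; no; does; _×-dec_; _⊎-dec_; ¬?)
open import Relation.Nullary.Decidable using (dec-true; proof; map′)
open import Relation.Nullary.Reflects using (Reflects; invert)
open import Relation.Binary using (Symmetric; Decidable; DecidableEquality)
open import Relation.Binary.Bundles using (Setoid)
open import Relation.Binary.PropositionalEquality hiding ([_])
import Relation.Binary.Reasoning.Setoid as SetoidReasoning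
open import Relation.Binary.Construct.Closure.ReflexiveTransitive using (Star; ε; _◅_; _◅◅_; gmap)
open import Algebra.Properties.Semiring.Sum +-*-semiring
  using (sum; sum-syntax; sum-remove; sum-cong-≗; sum-replicate-zero; ∑-distrib-+; ∑-comm)

-- For an edge e and a vertex x ∈ e, the branch at x away from e is the component of the
-- incidence graph minus e that contains x; let s(e,x) be its number of edges.  Counting
-- edges around a vertex w gives m = Σ_{e ∋ w} (1 + Σ_{x ∈ e, x ≠ w} s(e,x)), and similarly
-- s(e,x) = Σ_{f ∋ x, f ≠ e} (1 + Σ_{y ∈ f, y ≠ x} s(f,y)).
-- A vertex with d(w) ≡ 0 is a helpful 1-configuration.  If d(w) ≡ 2 and s(e,x) ≡ 1 for some
-- x ≠ w in an edge e ∋ w, take a leaf u in the branch at x away from e: the component of u in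
-- T - w is that branch, so P_T({u,w}) has m - d(w) - s(e,x) ≡ 0 edges.
-- If neither happens, induction on s(f,x) gives s(f,x) ≡ d(x) - 1: every vertex y ≠ x of an
-- edge e ≠ f through x has d(y) ≡ 1, since d(y) ≡ 2 would make the count around y yield
-- s(e,x) ≡ 1.  Then a vertex of degree ≡ 2 has all its branches ≡ 0 and forces m ≡ 2, so
-- every degree is ≡ 1, every branch is ≡ 0 and m ≡ 1.

-- Indicator sums

module _ {p} {P : Set p} where

  -- Only `does d` is inspected, so decisions built with map′ compute like the ones they wrap.
  when : Dec P → ℕ → ℕ
  when d k = if does d then k else 0

  𝟙 : Dec P → ℕ
  𝟙 d = when d 1

  when-yes : (d : Dec P) → P → ∀ k → when d k ≡ k
  when-yes (yes _) _ k = refl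
  when-yes (no ¬p) p k = ⊥-elim (¬p p)

  when-no : (d : Dec P) → ¬ P → ∀ k → when d k ≡ 0
  when-no (yes p) ¬p k = ⊥-elim (¬p p)
  when-no (no _) _ k = refl

  when-cong : (d : Dec P) {a b : ℕ} → (P → a ≡ b) → when d a ≡ when d b
  when-cong (yes p) a≡b = a≡b p
  when-cong (no _) _ = refl

  when-0 : (d : Dec P) → when d 0 ≡ 0
  when-0 (yes _) = refl
  when-0 (no _) = refl

  when-pos : (d : Dec P) {k : ℕ} → 0 < when d k → P
  when-pos (yes p) _ = p

  sum-when : ∀ {k} (d : Dec P) (f : Fin k → ℕ) → ∑[ i < k ] when d (f i) ≡ when d (sum f)
  sum-when (yes _) f = refl
  sum-when {k} (no _) f = sum-replicate-zero k

when-× : ∀ {p q} {P : Set p} {Q : Set q} (d : Dec P) (e : Dec Q) → ∀ k → when (d ×-dec e) k ≡ when d (when e k)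
when-× (yes _) (yes _) k = refl
when-× (yes _) (no _) k = refl
when-× (no _) _ k = refl

sum-𝟙-× : ∀ {p q k} {P : Set p} {Q : Fin k → Set q} (d : Dec P) (Q? : ∀ i → Dec (Q i)) →
          ∑[ i < k ] 𝟙 (d ×-dec Q? i) ≡ when d (∑[ i < k ] 𝟙 (Q? i))
sum-𝟙-× d Q? = trans (sum-cong-≗ (λ i → when-× d (Q? i) 1)) (sum-when d (𝟙 ∘ Q?))

≤-sum : ∀ {k} (f : Fin k → ℕ) i → f i ≤ sum f
≤-sum {suc k} f i = subst (f i ≤_) (sym (sum-remove {i = i} f)) (m≤m+n (f i) _)

≤-∑-when : ∀ {p k} {P : Fin k → Set p} (P? : ∀ i → Dec (P i)) (f : Fin k → ℕ) i → P i →
           f i ≤ ∑[ j < k ] when (P? j) (f j)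
≤-∑-when P? f i pi = subst (_≤ _) (when-yes (P? i) pi (f i)) (≤-sum (λ j → when (P? j) (f j)) i)

sum-pos : ∀ {k} (f : Fin k → ℕ) → 0 < sum f → ∃ λ i → 0 < f i
sum-pos {suc k} f pos with f zero in eq
... | suc _ = zero , subst (0 <_) (sym eq) (s≤s z≤n)
... | zero with sum-pos (f ∘ suc) pos
...   | i , fi>0 = suc i , fi>0

sum-ones : ∀ k → ∑[ i < k ] 1 ≡ k
sum-ones zero = refl
sum-ones (suc k) = cong suc (sum-ones k)

sum-𝟙-none : ∀ {p k} {P : Fin k → Set p} (P? : ∀ i → Dec (P i)) → (∀ i → ¬ P i) → ∑[ i < k ] 𝟙 (P? i) ≡ 0
sum-𝟙-none {k = zero} P? none = refl
sum-𝟙-none {k = suc k} P? none =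
  cong₂ _+_ (when-no (P? zero) (none zero) 1) (sum-𝟙-none (P? ∘ suc) (none ∘ suc))

sum-𝟙-unique : ∀ {p k} {P : Fin k → Set p} (P? : ∀ i → Dec (P i)) j → P j → (∀ i → P i → i ≡ j) →
               ∑[ i < k ] 𝟙 (P? i) ≡ 1
sum-𝟙-unique {k = suc k} {P} P? j pj unique = begin
  sum (𝟙 ∘ P?)                                ≡⟨ sum-remove {i = j} (𝟙 ∘ P?) ⟩
  𝟙 (P? j) + ∑[ i < k ] 𝟙 (P? (punchIn j i))  ≡⟨ cong₂ _+_ (when-yes (P? j) pj 1) (sum-𝟙-none (P? ∘ punchIn j) others) ⟩
  1                                           ∎
  where
  open ≡-Reasoning
  others : ∀ i → ¬ P (punchIn j i)
  others i p = punchInᵢ≢i j i (unique _ p)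

∣tabulate∣ : ∀ {k} (b : Fin k → Bool) → ∣ tabulate b ∣ ≡ ∑[ i < k ] (if b i then 1 else 0)
∣tabulate∣ {zero} b = refl
∣tabulate∣ {suc k} b with b zero
... | true = cong suc (∣tabulate∣ (b ∘ suc))
... | false = ∣tabulate∣ (b ∘ suc)

does-∈? : ∀ {k} (i : Fin k) (p : Subset k) → does (i ∈? p) ≡ lookup p i
does-∈? zero (inside ∷ p) = refl
does-∈? zero (outside ∷ p) = refl
does-∈? (suc i) (_ ∷ p) = does-∈? i p

subsetOf : ∀ {p k} {P : Fin k → Set p} → (∀ i → Dec (P i)) → Subset k
subsetOf P? = tabulate (does ∘ P?)

∈-subsetOf : ∀ {p k} {P : Fin k → Set p} (P? : ∀ i → Dec (P i)) i → i ∈ subsetOf P? ⇔ P i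
∈-subsetOf {P = P} P? i = mk⇔
  (λ i∈ → invert (subst (Reflects (P i)) (trans (sym (lookup∘tabulate (does ∘ P?) i)) ([]=⇒lookup i∈)) (proof (P? i))))
  (λ pi → lookup⇒[]= i _ (trans (lookup∘tabulate (does ∘ P?) i) (dec-true (P? i) pi)))

∣subsetOf∣ : ∀ {p k} {P : Fin k → Set p} (P? : ∀ i → Dec (P i)) → ∣ subsetOf P? ∣ ≡ ∑[ i < k ] 𝟙 (P? i)
∣subsetOf∣ P? = ∣tabulate∣ (does ∘ P?)

another-member : ∀ {k} (p : Subset k) → 2 ≤ ∣ p ∣ → ∀ x → ∃ λ y → y ∈ p × y ≢ x
another-member p 2≤∣p∣ x with any? (λ y → (y ∈? p) ×-dec ¬? (y ≟ᶠ x))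
... | yes (y , y∈p , y≢x) = y , y∈p , y≢x
... | no none = ⊥-elim (<⇒≱ 2≤∣p∣ (subst (∣ p ∣ ≤_) (∣⁅x⁆∣≡1 x) (p⊆q⇒∣p∣≤∣q∣ p⊆⁅x⁆)))
  where
  p⊆⁅x⁆ : ∀ {y} → y ∈ p → y ∈ ⁅ x ⁆
  p⊆⁅x⁆ {y} y∈p with y ≟ᶠ x
  ... | yes refl = x∈⁅x⁆ x
  ... | no y≢x = ⊥-elim (none (y , y∈p , y≢x))

-- Congruence modulo 3

-- A record rather than an equation between remainders, so that both sides stay inferable.
infix 4 _≡₃_
record _≡₃_ (a b : ℕ) : Set where
  constructor mod₃
  field
    %3≡ : a % 3 ≡ b % 3
open _≡₃_ public

≡₃-setoid : Setoid 0ℓ 0ℓ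
≡₃-setoid = record
  { Carrier = ℕ
  ; _≈_ = _≡₃_
  ; isEquivalence = record
    { refl = mod₃ refl
    ; sym = λ (mod₃ a≡b) → mod₃ (sym a≡b)
    ; trans = λ (mod₃ a≡b) (mod₃ b≡c) → mod₃ (trans a≡b b≡c)
    }
  }

open Setoid ≡₃-setoid public using () renaming (refl to ≡₃-refl; sym to ≡₃-sym; trans to ≡₃-trans)

≡⇒≡₃ : ∀ {a b} → a ≡ b → a ≡₃ b
≡⇒≡₃ refl = ≡₃-refl

+-cong₃ : ∀ {a a′ b b′} → a ≡₃ a′ → b ≡₃ b′ → a + b ≡₃ a′ + b′
+-cong₃ {a} {a′} {b} {b′} (mod₃ a≡a′) (mod₃ b≡b′) = mod₃ (begin
  (a + b) % 3             ≡⟨ %-distribˡ-+ a b 3 ⟩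
  (a % 3 + b % 3) % 3     ≡⟨ cong₂ (λ x y → (x + y) % 3) a≡a′ b≡b′ ⟩
  (a′ % 3 + b′ % 3) % 3   ≡⟨ %-distribˡ-+ a′ b′ 3 ⟨
  (a′ + b′) % 3           ∎)
  where open ≡-Reasoning

sum-cong₃ : ∀ {k} {f g : Fin k → ℕ} → (∀ i → f i ≡₃ g i) → sum f ≡₃ sum g
sum-cong₃ {zero} f≡g = ≡₃-refl
sum-cong₃ {suc k} f≡g = +-cong₃ (f≡g zero) (sum-cong₃ (f≡g ∘ suc))

sum≡₃0 : ∀ {k} {f : Fin k → ℕ} → (∀ i → f i ≡₃ 0) → sum f ≡₃ 0
sum≡₃0 {k} f≡0 = ≡₃-trans (sum-cong₃ f≡0) (≡⇒≡₃ (sum-replicate-zero k))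

when-cong₃ : ∀ {p} {P : Set p} (d : Dec P) {a b} → (P → a ≡₃ b) → when d a ≡₃ when d b
when-cong₃ (yes p) a≡b = a≡b p
when-cong₃ (no _) _ = ≡₃-refl

when≡₃0 : ∀ {p} {P : Set p} (d : Dec P) {a} → (P → a ≡₃ 0) → when d a ≡₃ 0
when≡₃0 d a≡0 = ≡₃-trans (when-cong₃ d a≡0) (≡⇒≡₃ (when-0 d))

residue : ∀ a → a ≡₃ 0 ⊎ a ≡₃ 1 ⊎ a ≡₃ 2
residue a with a % 3 in eq | m%n<n a 3
... | 0 | _ = inj₁ (mod₃ eq)
... | 1 | _ = inj₂ (inj₁ (mod₃ eq))
... | 2 | _ = inj₂ (inj₂ (mod₃ eq))
... | suc (suc (suc _)) | s≤s (s≤s (s≤s ()))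

sum-cong₃-except : ∀ {k} {f g : Fin k → ℕ} j {c} → f j ≡₃ g j + c → (∀ i → i ≢ j → f i ≡₃ g i) →
                   sum f ≡₃ sum g + c
sum-cong₃-except {suc k} {f} {g} j {c} fj≡gj+c others = begin
  sum f                                  ≡⟨ sum-remove {i = j} f ⟩
  f j + ∑[ i < k ] f (punchIn j i)       ≈⟨ +-cong₃ fj≡gj+c (sum-cong₃ (λ i → others _ (punchInᵢ≢i j i))) ⟩
  g j + c + rest                         ≡⟨ +-comm (g j + c) rest ⟩
  rest + (g j + c)                       ≡⟨ +-assoc rest (g j) c ⟨
  rest + g j + c                         ≡⟨ cong (_+ c) (+-comm rest (g j)) ⟩
  g j + rest + c                         ≡⟨ cong (_+ c) (sum-remove {i = j} g) ⟨
  sum g + c                              ∎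
  where
  open SetoidReasoning ≡₃-setoid
  rest : ℕ
  rest = ∑[ i < k ] g (punchIn j i)

≡₃1⇒>0 : ∀ {s} → s ≡₃ 1 → 0 < s
≡₃1⇒>0 {suc _} _ = s≤s z≤n

+-cancelˡ₃ : ∀ a {b c} → a + b ≡₃ a + c → b ≡₃ c
+-cancelˡ₃ a {b} {c} a+b≡a+c = begin
  b                  ≈⟨ mod₃ ([m+kn]%n≡m%n b a 3) ⟨
  b + a * 3          ≡⟨ rearrange a b ⟩
  a * 2 + (a + b)    ≈⟨ +-cong₃ (≡₃-refl {a * 2}) a+b≡a+c ⟩
  a * 2 + (a + c)    ≡⟨ rearrange a c ⟨
  c + a * 3          ≈⟨ mod₃ ([m+kn]%n≡m%n c a 3) ⟩
  c                  ∎
  where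
  open SetoidReasoning ≡₃-setoid
  rearrange : ∀ a b → b + a * 3 ≡ a * 2 + (a + b)
  rearrange = solve-∀

2+s≡₃0⇒s≡₃1 : ∀ {a s} → a ≡₃ 2 → a + s ≡₃ 0 → s ≡₃ 1
2+s≡₃0⇒s≡₃1 a≡2 a+s≡0 = +-cancelˡ₃ 2 (≡₃-trans (+-cong₃ (≡₃-sym a≡2) ≡₃-refl) (≡₃-trans a+s≡0 (mod₃ refl)))

module Walks {V : Set} (_≟_ : DecidableEquality V) {_~_ : V → V → Set} (~-sym : Symmetric _~_) where

  Walk : (V → Set) → V → V → Set
  Walk A = Star (λ x y → A x × A y × x ~ y)

  walk-mono : ∀ {A B : V → Set} → (∀ {z} → A z → B z) → ∀ {x y} → Walk A x y → Walk B x y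
  walk-mono A⊆B = gmap id (λ { (ax , ay , x~y) → A⊆B ax , A⊆B ay , x~y })

  reverse : ∀ {A x y} → Walk A x y → Walk A y x
  reverse ε = ε
  reverse ((ax , ay , x~y) ◅ w) = reverse w ◅◅ ((ay , ax , ~-sym x~y) ◅ ε)

  source-inside : ∀ {A x y} → Walk A x y → x ≡ y ⊎ A x
  source-inside ε = inj₁ refl
  source-inside ((ax , _ , _) ◅ _) = inj₂ ax

  target-inside : ∀ {A x y} → Walk A x y → x ≡ y ⊎ A y
  target-inside w with source-inside (reverse w)
  ... | inj₁ y≡x = inj₁ (sym y≡x)
  ... | inj₂ ay = inj₂ ay

  restrict : ∀ {A B : V → Set} {x y} → (∀ z → Walk A x z → B z) → Walk A x y → Walk B x y
  restrict B-reached ε = ε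
  restrict {x = x} B-reached (s@(_ , _ , x~z) ◅ w) =
    (B-reached x ε , B-reached _ (s ◅ ε) , x~z) ◅ restrict (λ z w′ → B-reached z (s ◅ w′)) w

  avoid-or-reach : ∀ {A x y} r → Walk A x y → Walk (A ∩ (_≢ r)) x y ⊎ Walk A x r
  avoid-or-reach r ε = inj₁ ε
  avoid-or-reach {x = x} r (_◅_ {j = z} s@(ax , az , x~z) w) with x ≟ r
  ... | yes refl = inj₂ ε
  ... | no x≢r with avoid-or-reach r w
  ...   | inj₂ w′ = inj₂ (s ◅ w′)
  ...   | inj₁ w′ with z ≟ r
  ...     | yes refl = inj₂ (s ◅ ε)
  ...     | no z≢r = inj₁ (((ax , x≢r) , (az , z≢r) , x~z) ◅ w′)

  last-exit : ∀ {A x y} r → y ≢ r → Walk A x y →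
              Walk (A ∩ (_≢ r)) x y ⊎ ∃ λ r′ → r ~ r′ × A r′ × Walk (A ∩ (_≢ r)) r′ y
  last-exit r y≢r ε = inj₁ ε
  last-exit {x = x} r y≢r ((ax , az , x~z) ◅ w) with last-exit r y≢r w
  ... | inj₂ exit = inj₂ exit
  ... | inj₁ w′ with x ≟ r
  ...   | yes refl = inj₂ (_ , x~z , az , w′)
  ...   | no x≢r with source-inside w′
  ...     | inj₂ (_ , z≢r) = inj₁ (((ax , x≢r) , (az , z≢r) , x~z) ◅ w′)
  ...     | inj₁ refl = inj₁ (((ax , x≢r) , (az , y≢r) , x~z) ◅ w′)

  EndsAt : V → List V → V → Set
  EndsAt x [] y = x ≡ y
  EndsAt x (z ∷ zs) y = EndsAt z zs y

  EndsAt-∷ʳ : ∀ x ys z {y} → EndsAt x (ys ++ [ z ]) y → z ≡ y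
  EndsAt-∷ʳ x [] z en = en
  EndsAt-∷ʳ x (w ∷ ys) z en = EndsAt-∷ʳ w ys z en

  record Path (A : V → Set) (x y : V) : Set where
    constructor path
    field
      rest   : List V
      linked : Linked _~_ (x ∷ rest)
      unique : Unique (x ∷ rest)
      within : All A (x ∷ rest)
      ends   : EndsAt x rest y

  private
    suffix-path : ∀ {A x y z} zs → Linked _~_ (z ∷ zs) → Unique (z ∷ zs) → All A (z ∷ zs) →
                  EndsAt z zs y → x ∈ₗ (z ∷ zs) → Path A x y
    suffix-path zs lk un al en (here refl) = path zs lk un al en
    suffix-path (_ ∷ zs) (_ ∷ lk) (_ ∷ un) (_ ∷ al) en (there x∈zs) = suffix-path zs lk un al en x∈zs

    ∉⇒All≢ : ∀ {x} (zs : List V) → ¬ (x ∈ₗ zs) → All (x ≢_) zs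
    ∉⇒All≢ [] _ = []
    ∉⇒All≢ (z ∷ zs) x∉ = (x∉ ∘ here) ∷ ∉⇒All≢ zs (x∉ ∘ there)

  open import Data.List.Membership.DecPropositional _≟_ using () renaming (_∈?_ to _∈ₗ?_)

  walk⇒path : ∀ {A x y} → A x → Walk A x y → Path A x y
  walk⇒path ax ε = path [] [-] ([] ∷ []) (ax ∷ []) refl
  walk⇒path {x = x} ax ((_ , az , x~z) ◅ w) with walk⇒path az w
  ... | path zs lk un al en with x ∈ₗ? (_ ∷ zs)
  ...   | yes x∈ = suffix-path zs lk un al en x∈
  ...   | no x∉ = path (_ ∷ zs) (x~z ∷ lk) (∉⇒All≢ _ x∉ ∷ un) (ax ∷ al) en

  module Decide (_~?_ : Decidable _~_) {N} (enum : Fin N ↔ V) where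
    open Inverse enum using (to; from; strictlyInverseˡ)

    any-node? : {P : V → Set} → (∀ z → Dec (P z)) → Dec (∃ P)
    any-node? {P} P? with any? (P? ∘ to)
    ... | yes (i , p) = yes (to i , p)
    ... | no none = no λ (z , pz) → none (from z , subst P (sym (strictlyInverseˡ z)) pz)

    unique⇒length≤ : ∀ {xs : List V} → Unique xs → length xs ≤ N
    unique⇒length≤ {xs} un = injective⇒≤ (lookup-injective xs un ∘ from-injective)
      where
      from-injective : ∀ {u v} → from u ≡ from v → u ≡ v
      from-injective {u} {v} eq = trans (sym (strictlyInverseˡ u)) (trans (cong to eq) (strictlyInverseˡ v))
      lookup-injective : ∀ xs → Unique xs → ∀ {i j} → List.lookup xs i ≡ List.lookup xs j → i ≡ j
      lookup-injective (x ∷ xs) un {zero} {zero} _ = refl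
      lookup-injective (x ∷ xs) (x∉ ∷ _) {zero} {suc j} eq = ⊥-elim (All.lookup x∉ (∈-lookup j) eq)
      lookup-injective (x ∷ xs) (x∉ ∷ _) {suc i} {zero} eq = ⊥-elim (All.lookup x∉ (∈-lookup i) (sym eq))
      lookup-injective (x ∷ xs) (_ ∷ un) {suc i} {suc j} eq = cong suc (lookup-injective xs un eq)

    module _ {A : V → Set} (A? : ∀ z → Dec (A z)) where
      WalkWithin : ℕ → V → V → Set
      WalkWithin zero x y = x ≡ y
      WalkWithin (suc k) x y = x ≡ y ⊎ ∃ λ z → (A x × A z × x ~ z) × WalkWithin k z y

      walkWithin? : ∀ k x y → Dec (WalkWithin k x y)
      walkWithin? zero x y = x ≟ y
      walkWithin? (suc k) x y =
        (x ≟ y) ⊎-dec any-node? (λ z → (A? x ×-dec (A? z ×-dec (x ~? z))) ×-dec walkWithin? k z y)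

      walkWithin⇒walk : ∀ k {x y} → WalkWithin k x y → Walk A x y
      walkWithin⇒walk zero refl = ε
      walkWithin⇒walk (suc k) (inj₁ refl) = ε
      walkWithin⇒walk (suc k) (inj₂ (_ , s , w)) = s ◅ walkWithin⇒walk k w

      walkWithin-mono : ∀ {k l} → k ≤ l → ∀ {x y} → WalkWithin k x y → WalkWithin l x y
      walkWithin-mono {zero} {zero} _ w = w
      walkWithin-mono {zero} {suc l} _ w = inj₁ w
      walkWithin-mono {suc k} {suc l} _ (inj₁ x≡y) = inj₁ x≡y
      walkWithin-mono {suc k} {suc l} (s≤s k≤l) (inj₂ (z , s , w)) = inj₂ (z , s , walkWithin-mono k≤l w)

      path⇒walkWithin : ∀ {x y} zs → Linked _~_ (x ∷ zs) → All A (x ∷ zs) → EndsAt x zs y →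
                        WalkWithin (length zs) x y
      path⇒walkWithin [] _ _ x≡y = x≡y
      path⇒walkWithin (z ∷ zs) (x~z ∷ lk) (ax ∷ az ∷ al) en =
        inj₂ (z , (ax , az , x~z) , path⇒walkWithin zs lk (az ∷ al) en)

      -- A walk shortens to a path, and a path visits at most N nodes.
      walk? : ∀ x y → Dec (Walk A x y)
      walk? x y with x ≟ y
      ... | yes refl = yes ε
      ... | no x≢y with walkWithin? N x y
      ...   | yes w = yes (walkWithin⇒walk N w)
      ...   | no ¬w = no λ w → shorten w
        where
        shorten : Walk A x y → ⊥
        shorten w with source-inside w
        ... | inj₁ x≡y = x≢y x≡y
        ... | inj₂ ax with walk⇒path ax w
        ...   | path zs lk un al en =
                ¬w (walkWithin-mono (≤-trans (n≤1+n _) (unique⇒length≤ un)) (path⇒walkWithin zs lk al en))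

module Incidence (T : Hypergraph) where
  open Hypergraph T

  infix 4 _⇝_ _⇝?_ _≟ₙ_

  _⇝_ : Node T → Node T → Set
  _⇝_ = _~_ T

  ⇝-sym : ∀ {x y} → x ⇝ y → y ⇝ x
  ⇝-sym (ve p) = ev p
  ⇝-sym (ev p) = ve p

  ⇝-irrefl : ∀ {x y} → x ⇝ y → x ≢ y
  ⇝-irrefl (ve _) ()
  ⇝-irrefl (ev _) ()

  _⇝?_ : ∀ x y → Dec (x ⇝ y)
  inj₁ v ⇝? inj₁ w = no λ ()
  inj₂ e ⇝? inj₂ f = no λ ()
  inj₁ v ⇝? inj₂ e = map′ ve (λ { (ve p) → p }) (v ∈? edge e)
  inj₂ e ⇝? inj₁ v = map′ ev (λ { (ev p) → p }) (v ∈? edge e)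

  _≟ₙ_ : DecidableEquality (Node T)
  _≟ₙ_ = Sum.≡-dec _≟ᶠ_ _≟ᶠ_

  open Walks _≟ₙ_ {_⇝_} ⇝-sym public
  open Decide _⇝?_ +↔⊎ public using (walk?)

  ∑ₙ : (Node T → ℕ) → ℕ
  ∑ₙ f = sum (f ∘ inj₁) + sum (f ∘ inj₂)

  ∑ₙ-𝟙-none : ∀ {P : Node T → Set} (P? : ∀ z → Dec (P z)) → (∀ z → ¬ P z) → ∑ₙ (𝟙 ∘ P?) ≡ 0
  ∑ₙ-𝟙-none P? none = cong₂ _+_ (sum-𝟙-none (P? ∘ inj₁) (none ∘ inj₁)) (sum-𝟙-none (P? ∘ inj₂) (none ∘ inj₂))

  ∑ₙ-𝟙-unique : ∀ {P : Node T → Set} (P? : ∀ z → Dec (P z)) j → P j → (∀ z → P z → z ≡ j) → ∑ₙ (𝟙 ∘ P?) ≡ 1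
  ∑ₙ-𝟙-unique P? (inj₁ j) pj unique =
    cong₂ _+_ (sum-𝟙-unique (P? ∘ inj₁) j pj (λ i → Sum.inj₁-injective ∘ unique (inj₁ i)))
              (sum-𝟙-none (P? ∘ inj₂) (λ i p → inj₂≢inj₁ (unique (inj₂ i) p)))
    where
    inj₂≢inj₁ : ∀ {i} → inj₂ i ≢ inj₁ j
    inj₂≢inj₁ ()
  ∑ₙ-𝟙-unique P? (inj₂ j) pj unique =
    cong₂ _+_ (sum-𝟙-none (P? ∘ inj₁) (λ i p → inj₁≢inj₂ (unique (inj₁ i) p)))
              (sum-𝟙-unique (P? ∘ inj₂) j pj (λ i → Sum.inj₂-injective ∘ unique (inj₂ i)))
    where
    inj₁≢inj₂ : ∀ {i} → inj₁ i ≢ inj₂ j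
    inj₁≢inj₂ ()

  ∑ₙ-cong : ∀ {f g : Node T → ℕ} → (∀ z → f z ≡ g z) → ∑ₙ f ≡ ∑ₙ g
  ∑ₙ-cong f≗g = cong₂ _+_ (sum-cong-≗ (f≗g ∘ inj₁)) (sum-cong-≗ (f≗g ∘ inj₂))

  ∑ₙ-comm : ∀ {k} (f : Fin k → Node T → ℕ) → ∑[ i < k ] ∑ₙ (f i) ≡ ∑ₙ (λ z → ∑[ i < k ] f i z)
  ∑ₙ-comm f = trans (∑-distrib-+ (λ i → sum (f i ∘ inj₁)) (λ i → sum (f i ∘ inj₂)))
                    (cong₂ _+_ (∑-comm (λ i → f i ∘ inj₁)) (∑-comm (λ i → f i ∘ inj₂)))

  ∑ₙ-around-vertex : ∀ v (f : Node T → ℕ) →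
                     ∑ₙ (λ z → when (inj₁ v ⇝? z) (f z)) ≡ ∑[ e < m ] when (v ∈? edge e) (f (inj₂ e))
  ∑ₙ-around-vertex v f = cong (_+ ∑[ e < m ] when (v ∈? edge e) (f (inj₂ e))) (sum-replicate-zero n)

  ∑ₙ-around-edge : ∀ e (f : Node T → ℕ) →
                   ∑ₙ (λ z → when (inj₂ e ⇝? z) (f z)) ≡ ∑[ x < n ] when (x ∈? edge e) (f (inj₁ x))
  ∑ₙ-around-edge e f =
    trans (cong (∑[ x < n ] when (x ∈? edge e) (f (inj₁ x)) +_) (sum-replicate-zero m)) (+-identityʳ _)

  degree-sum : ∀ v → d T v ≡ ∑[ e < m ] 𝟙 (v ∈? edge e)
  degree-sum v = trans (∣tabulate∣ (λ e → lookup (edge e) v))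
                       (sum-cong-≗ λ e → cong (if_then 1 else 0) (sym (does-∈? v (edge e))))

module Branches (T : Hypergraph) (tree : IsHypertree T) where
  open Hypergraph T
  open Incidence T

  Branch : Node T → Node T → Node T → Set
  Branch a = Walk (_≢ a)

  branch? : ∀ a b c → Dec (Branch a b c)
  branch? a = walk? (λ z → ¬? (z ≟ₙ a))

  branches-disjoint : ∀ {a b c} → a ⇝ b → a ⇝ c → b ≢ c → ¬ Branch a b c
  branches-disjoint {a} {b} {c} a⇝b a⇝c b≢c w with walk⇒path (⇝-irrefl a⇝b ∘ sym) w
  ... | path zs lk un al en with initLast zs
  ...   | [] = b≢c en
  ...   | ys ∷ʳ′ z = proj₂ (proj₂ tree)
          (a , b ∷ ys , z , a⇝b ∷ lk , All.map (_∘ sym) al ∷ un , s≤s z≤n ,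
           subst (_⇝ a) (sym (EndsAt-∷ʳ b ys z en)) (⇝-sym a⇝c))

  root∉branch : ∀ {a b} → a ⇝ b → ¬ Branch a b a
  root∉branch a⇝b w with target-inside w
  ... | inj₁ b≡a = ⇝-irrefl a⇝b (sym b≡a)
  ... | inj₂ a≢a = a≢a refl

  branch-unique : ∀ {a b b′ c} → a ⇝ b → a ⇝ b′ → Branch a b c → Branch a b′ c → b ≡ b′
  branch-unique {b = b} {b′} a⇝b a⇝b′ w w′ with b ≟ₙ b′
  ... | yes b≡b′ = b≡b′
  ... | no b≢b′ = ⊥-elim (branches-disjoint a⇝b a⇝b′ b≢b′ (w ◅◅ reverse w′))

  branch-exists : ∀ {a c} → c ≢ a → ∃ λ b → a ⇝ b × Branch a b c
  branch-exists {a} {c} c≢a with last-exit a c≢a (gmap id (λ a⇝b → tt , tt , a⇝b) (proj₁ (proj₂ tree) a c))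
  ... | inj₂ (b , a⇝b , _ , w) = b , a⇝b , walk-mono proj₂ w
  ... | inj₁ w with source-inside w
  ...   | inj₁ a≡c = ⊥-elim (c≢a (sym a≡c))
  ...   | inj₂ (_ , a≢a) = ⊥-elim (a≢a refl)

  branch-extend : ∀ {a b b′ c} → a ⇝ b → b ⇝ b′ → b′ ≢ a → Branch b b′ c → Branch a b c
  branch-extend a⇝b b⇝b′ b′≢a w with avoid-or-reach _ w
  ... | inj₂ w′ = ⊥-elim (branches-disjoint b⇝b′ (⇝-sym a⇝b) b′≢a w′)
  ... | inj₁ w′ = ((⇝-irrefl a⇝b ∘ sym) , b′≢a , b⇝b′) ◅ walk-mono proj₂ w′

  branch-antisym : ∀ {a b c} → a ⇝ b → Branch a b c → ¬ Branch b a c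
  branch-antisym {a} {b} {c} a⇝b w w′ with c ≟ₙ a
  ... | yes refl = root∉branch a⇝b w
  ... | no c≢a with last-exit a c≢a w′
  ...   | inj₂ (a′ , a⇝a′ , a′≢b , w″) = branches-disjoint a⇝a′ a⇝b a′≢b (walk-mono proj₂ w″ ◅◅ reverse w)
  ...   | inj₁ w″ with source-inside w″
  ...     | inj₁ a≡c = c≢a (sym a≡c)
  ...     | inj₂ (_ , a≢a) = a≢a refl

  branch-descend : ∀ {a b c} → a ⇝ b → Branch a b c → c ≢ b → ∃ λ b′ → b ⇝ b′ × b′ ≢ a × Branch b b′ c
  branch-descend {a} a⇝b w c≢b with branch-exists c≢b
  ... | b′ , b⇝b′ , w′ with b′ ≟ₙ a
  ...   | yes refl = ⊥-elim (branch-antisym a⇝b w w′)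
  ...   | no b′≢a = b′ , b⇝b′ , b′≢a , w′

  leads-to? : ∀ a c b → Dec (a ⇝ b × Branch a b c)
  leads-to? a c b = (a ⇝? b) ×-dec branch? a b c

  leads-away-to? : ∀ a b c b′ → Dec (b ⇝ b′ × b′ ≢ a × Branch b b′ c)
  leads-away-to? a b c b′ = (b ⇝? b′) ×-dec (¬? (b′ ≟ₙ a) ×-dec branch? b b′ c)

  branch-count : ∀ {a b} → a ⇝ b → ∀ c → 𝟙 (branch? a b c) ≡ 𝟙 (c ≟ₙ b) + ∑ₙ (𝟙 ∘ leads-away-to? a b c)
  branch-count {a} {b} a⇝b c with c ≟ₙ b
  ... | yes refl = trans (when-yes (branch? a b b) ε 1)
                     (cong suc (sym (∑ₙ-𝟙-none (leads-away-to? a b b) λ { _ (b⇝b′ , _ , w) → root∉branch b⇝b′ w })))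
  ... | no c≢b with branch? a b c
  ...   | yes w with branch-descend a⇝b w c≢b
  ...     | b′ , b⇝b′ , b′≢a , w′ = sym (∑ₙ-𝟙-unique (leads-away-to? a b c) b′ (b⇝b′ , b′≢a , w′)
                                      λ { _ (b⇝z , _ , wz) → branch-unique b⇝z b⇝b′ wz w′ })
  branch-count {a} {b} a⇝b c | no c≢b | no ¬w =
    sym (∑ₙ-𝟙-none (leads-away-to? a b c) λ { _ (b⇝b′ , b′≢a , w′) → ¬w (branch-extend a⇝b b⇝b′ b′≢a w′) })

  neighbour-count : ∀ a c → 𝟙 (¬? (c ≟ₙ a)) ≡ ∑ₙ (𝟙 ∘ leads-to? a c)
  neighbour-count a c with c ≟ₙ a
  ... | yes refl = sym (∑ₙ-𝟙-none (leads-to? a a) λ { _ (a⇝b , w) → root∉branch a⇝b w })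
  ... | no c≢a with branch-exists c≢a
  ...   | b , a⇝b , w = sym (∑ₙ-𝟙-unique (leads-to? a c) b (a⇝b , w) λ { _ (a⇝z , wz) → branch-unique a⇝z a⇝b wz w })

  edgesIn : Node T → Node T → ℕ
  edgesIn a b = ∑[ g < m ] 𝟙 (branch? a b (inj₂ g))

  edges-outside : ∀ a → ∑[ g < m ] 𝟙 (¬? (inj₂ g ≟ₙ a)) ≡ ∑ₙ (λ b → when (a ⇝? b) (edgesIn a b))
  edges-outside a = begin
    ∑[ g < m ] 𝟙 (¬? (inj₂ g ≟ₙ a))                   ≡⟨ sum-cong-≗ (neighbour-count a ∘ inj₂) ⟩
    ∑[ g < m ] ∑ₙ (𝟙 ∘ leads-to? a (inj₂ g))           ≡⟨ ∑ₙ-comm (λ g → 𝟙 ∘ leads-to? a (inj₂ g)) ⟩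
    ∑ₙ (λ b → ∑[ g < m ] 𝟙 (leads-to? a (inj₂ g) b))  ≡⟨ ∑ₙ-cong (λ b → sum-𝟙-× (a ⇝? b) (branch? a b ∘ inj₂)) ⟩
    ∑ₙ (λ b → when (a ⇝? b) (edgesIn a b))            ∎
    where open ≡-Reasoning

  edgesIn-rec : ∀ {a b} → a ⇝ b → edgesIn a b ≡
    ∑[ g < m ] 𝟙 (inj₂ g ≟ₙ b) + ∑ₙ (λ b′ → when (b ⇝? b′) (when (¬? (b′ ≟ₙ a)) (edgesIn b b′)))
  edgesIn-rec {a} {b} a⇝b = begin
    edgesIn a b
      ≡⟨ sum-cong-≗ (branch-count a⇝b ∘ inj₂) ⟩
    ∑[ g < m ] (𝟙 (inj₂ g ≟ₙ b) + ∑ₙ (𝟙 ∘ leads-away-to? a b (inj₂ g)))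
      ≡⟨ ∑-distrib-+ (λ g → 𝟙 (inj₂ g ≟ₙ b)) (λ g → ∑ₙ (𝟙 ∘ leads-away-to? a b (inj₂ g))) ⟩
    at-b + ∑[ g < m ] ∑ₙ (𝟙 ∘ leads-away-to? a b (inj₂ g))
      ≡⟨ cong (at-b +_) (∑ₙ-comm (λ g → 𝟙 ∘ leads-away-to? a b (inj₂ g))) ⟩
    at-b + ∑ₙ (λ b′ → ∑[ g < m ] 𝟙 (leads-away-to? a b (inj₂ g) b′))
      ≡⟨ cong (at-b +_) (∑ₙ-cong λ b′ →
           trans (sum-𝟙-× (b ⇝? b′) (λ g → ¬? (b′ ≟ₙ a) ×-dec branch? b b′ (inj₂ g)))
                 (cong (when (b ⇝? b′)) (sum-𝟙-× (¬? (b′ ≟ₙ a)) (branch? b b′ ∘ inj₂)))) ⟩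
    at-b + ∑ₙ (λ b′ → when (b ⇝? b′) (when (¬? (b′ ≟ₙ a)) (edgesIn b b′))) ∎
    where
    open ≡-Reasoning
    at-b : ℕ
    at-b = ∑[ g < m ] 𝟙 (inj₂ g ≟ₙ b)

  -- s(e,x) of the proof sketch; sizeᵉ x e counts the branch at e away from x, e included.
  sizeᵛ : Fin m → Fin n → ℕ
  sizeᵛ e x = edgesIn (inj₂ e) (inj₁ x)

  sizeᵉ : Fin n → Fin m → ℕ
  sizeᵉ x e = edgesIn (inj₁ x) (inj₂ e)

  edges-around-vertex : ∀ w → m ≡ ∑[ e < m ] when (w ∈? edge e) (sizeᵉ w e)
  edges-around-vertex w =
    trans (sym (sum-ones m)) (trans (edges-outside (inj₁ w)) (∑ₙ-around-vertex w (edgesIn (inj₁ w))))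

  sizeᵉ-rec : ∀ {w e} → w ∈ edge e → sizeᵉ w e ≡ 1 + ∑[ x < n ] when (x ∈? edge e) (when (¬? (x ≟ᶠ w)) (sizeᵛ e x))
  sizeᵉ-rec {w} {e} w∈e = trans (edgesIn-rec (ve w∈e))
    (cong₂ _+_ (sum-𝟙-unique (_≟ᶠ e) e refl (λ _ g≡e → g≡e))
               (∑ₙ-around-edge e (λ z → when (¬? (z ≟ₙ inj₁ w)) (edgesIn (inj₂ e) z))))

  sizeᵛ-rec : ∀ {x f} → x ∈ edge f → sizeᵛ f x ≡ ∑[ e < m ] when (x ∈? edge e) (when (¬? (e ≟ᶠ f)) (sizeᵉ x e))
  sizeᵛ-rec {x} {f} x∈f = trans (edgesIn-rec (ev x∈f))
    (cong₂ _+_ (sum-replicate-zero m)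
               (∑ₙ-around-vertex x (λ z → when (¬? (z ≟ₙ inj₂ f)) (edgesIn (inj₁ x) z))))

  sizeᵉ-pos : ∀ {w e} → w ∈ edge e → 0 < sizeᵉ w e
  sizeᵉ-pos w∈e = subst (0 <_) (sym (sizeᵉ-rec w∈e)) (s≤s z≤n)

  sizeᵛ<sizeᵉ : ∀ {x e y} → x ∈ edge e → y ∈ edge e → y ≢ x → sizeᵛ e y < sizeᵉ x e
  sizeᵛ<sizeᵉ {x} {e} {y} x∈e y∈e y≢x = begin-strict
    sizeᵛ e y                                                         ≡⟨ when-yes (¬? (y ≟ᶠ x)) y≢x _ ⟨
    when (¬? (y ≟ᶠ x)) (sizeᵛ e y)                                    ≤⟨ ≤-∑-when (λ z → z ∈? edge e) _ y y∈e ⟩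
    ∑[ z < n ] when (z ∈? edge e) (when (¬? (z ≟ᶠ x)) (sizeᵛ e z))    <⟨ n<1+n _ ⟩
    1 + ∑[ z < n ] when (z ∈? edge e) (when (¬? (z ≟ᶠ x)) (sizeᵛ e z)) ≡⟨ sizeᵉ-rec x∈e ⟨
    sizeᵉ x e                                                         ∎
    where open ≤-Reasoning

  sizeᵉ≤sizeᵛ : ∀ {x f e} → x ∈ edge f → x ∈ edge e → e ≢ f → sizeᵉ x e ≤ sizeᵛ f x
  sizeᵉ≤sizeᵛ {x} {f} {e} x∈f x∈e e≢f = begin
    sizeᵉ x e                                                           ≡⟨ when-yes (¬? (e ≟ᶠ f)) e≢f _ ⟨
    when (¬? (e ≟ᶠ f)) (sizeᵉ x e)                                      ≤⟨ ≤-∑-when (λ e′ → x ∈? edge e′) _ e x∈e ⟩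
    ∑[ e′ < m ] when (x ∈? edge e′) (when (¬? (e′ ≟ᶠ f)) (sizeᵉ x e′))  ≡⟨ sizeᵛ-rec x∈f ⟨
    sizeᵛ f x                                                           ∎
    where open ≤-Reasoning

  sizeᵛ-child< : ∀ {f x e y} → x ∈ edge f → x ∈ edge e → e ≢ f → y ∈ edge e → y ≢ x → sizeᵛ e y < sizeᵛ f x
  sizeᵛ-child< x∈f x∈e e≢f y∈e y≢x = <-≤-trans (sizeᵛ<sizeᵉ x∈e y∈e y≢x) (sizeᵉ≤sizeᵛ x∈f x∈e e≢f)

  degree-one : ∀ {y e} → y ∈ edge e → sizeᵛ e y ≡ 0 → d T y ≡ 1
  degree-one {y} {e} y∈e size≡0 = trans (degree-sum y) (sum-𝟙-unique (λ g → y ∈? edge g) e y∈e only-e)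
    where
    only-e : ∀ g → y ∈ edge g → g ≡ e
    only-e g y∈g with g ≟ᶠ e
    ... | yes g≡e = g≡e
    ... | no g≢e = ⊥-elim (<-irrefl (sym size≡0) (<-≤-trans (sizeᵉ-pos y∈g) (sizeᵉ≤sizeᵛ y∈e y∈g g≢e)))

  next-edge : ∀ {e x} → x ∈ edge e → 0 < sizeᵛ e x → ∃ λ e′ → x ∈ edge e′ × e′ ≢ e
  next-edge {e} {x} x∈e pos
    with sum-pos (λ e′ → when (x ∈? edge e′) (when (¬? (e′ ≟ᶠ e)) (sizeᵉ x e′))) (subst (0 <_) (sizeᵛ-rec x∈e) pos)
  ... | e′ , pos′ with when-pos (x ∈? edge e′) pos′
  ...   | x∈e′ = e′ , x∈e′ , when-pos (¬? (e′ ≟ᶠ e)) (subst (0 <_) (when-yes (x ∈? edge e′) x∈e′ _) pos′)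

  private
    leaf-beyond′ : ∀ k {e x} → sizeᵛ e x < k → x ∈ edge e → 0 < sizeᵛ e x →
                   ∃ λ u → Leaf T u × Branch (inj₂ e) (inj₁ x) (inj₁ u) × u ≢ x
    leaf-beyond′ (suc k) {e} {x} (s≤s size≤k) x∈e pos with next-edge x∈e pos
    ... | e′ , x∈e′ , e′≢e with any? (λ y → (y ∈? edge e′) ×-dec (¬? (y ≟ᶠ x) ×-dec (0 <? sizeᵛ e′ y)))
    ...   | yes (y , y∈e′ , y≢x , pos′)
            with leaf-beyond′ k (≤-trans (sizeᵛ-child< x∈e x∈e′ e′≢e y∈e′ y≢x) size≤k) y∈e′ pos′
    ...     | u , u-leaf , y⇝u , u≢y =
              u , u-leaf ,
              branch-extend (ev x∈e) (ve x∈e′) (e′≢e ∘ Sum.inj₂-injective)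
                (branch-extend (ve x∈e′) (ev y∈e′) (y≢x ∘ Sum.inj₁-injective) y⇝u) ,
              λ { refl → branches-disjoint (ev y∈e′) (ev x∈e′) (y≢x ∘ Sum.inj₁-injective) y⇝u }
    leaf-beyond′ (suc k) {e} {x} _ x∈e pos | e′ , x∈e′ , e′≢e | no none
      with another-member (edge e′) (edge-size e′) x
    ... | y , y∈e′ , y≢x =
          y , (degree-one y∈e′ (barren y∈e′ y≢x) , e′ , y∈e′ , leaf-edge) ,
          ((λ ()) , e′≢e ∘ Sum.inj₂-injective , ve x∈e′) ◅ (e′≢e ∘ Sum.inj₂-injective , (λ ()) , ev y∈e′) ◅ ε ,
          y≢x
      where
      barren : ∀ {z} → z ∈ edge e′ → z ≢ x → sizeᵛ e′ z ≡ 0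
      barren {z} z∈e′ z≢x = n≤0⇒n≡0 (≮⇒≥ λ pos′ → none (z , z∈e′ , z≢x , pos′))
      only-x : ∀ z → z ∈ edge e′ → 1 < d T z → z ≡ x
      only-x z z∈e′ 1<dz with z ≟ᶠ x
      ... | yes z≡x = z≡x
      ... | no z≢x = ⊥-elim (<-irrefl (sym (degree-one z∈e′ (barren z∈e′ z≢x))) 1<dz)
      leaf-edge : LeafEdge T e′
      leaf-edge p q p∈e′ q∈e′ 1<dp 1<dq = trans (only-x p p∈e′ 1<dp) (sym (only-x q q∈e′ 1<dq))

  leaf-beyond : ∀ {e x} → x ∈ edge e → 0 < sizeᵛ e x → ∃ λ u → Leaf T u × Branch (inj₂ e) (inj₁ x) (inj₁ u) × u ≢ x
  leaf-beyond = leaf-beyond′ _ ≤-refl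

module Residues (T : Hypergraph) (tree : IsHypertree T) where
  open Hypergraph T
  open Incidence T
  open Branches T tree
  open SetoidReasoning ≡₃-setoid

  sizeᵉ≡₃1 : ∀ {w e} → w ∈ edge e → (∀ x → x ∈ edge e → x ≢ w → sizeᵛ e x ≡₃ 0) → sizeᵉ w e ≡₃ 1
  sizeᵉ≡₃1 {w} {e} w∈e vanish = begin
    sizeᵉ w e                                                            ≡⟨ sizeᵉ-rec w∈e ⟩
    1 + ∑[ x < n ] when (x ∈? edge e) (when (¬? (x ≟ᶠ w)) (sizeᵛ e x))  ≈⟨ +-cong₃ ≡₃-refl (sum≡₃0 vanish′) ⟩
    1                                                                    ∎
    where
    vanish′ : ∀ x → when (x ∈? edge e) (when (¬? (x ≟ᶠ w)) (sizeᵛ e x)) ≡₃ 0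
    vanish′ x = when≡₃0 (x ∈? edge e) λ x∈e → when≡₃0 (¬? (x ≟ᶠ w)) (vanish x x∈e)

  sizeᵉ≡₃1+ : ∀ {w e x} → w ∈ edge e → x ∈ edge e → x ≢ w →
              (∀ z → z ∈ edge e → z ≢ w → z ≢ x → sizeᵛ e z ≡₃ 0) → sizeᵉ w e ≡₃ 1 + sizeᵛ e x
  sizeᵉ≡₃1+ {w} {e} {x} w∈e x∈e x≢w vanish = begin
    sizeᵉ w e                           ≡⟨ sizeᵉ-rec w∈e ⟩
    1 + sum beyond                      ≈⟨ +-cong₃ ≡₃-refl (sum-cong₃-except {g = λ _ → 0} x beyond-x vanish′) ⟩
    1 + (∑[ _ < n ] 0 + sizeᵛ e x)      ≡⟨ cong (λ a → 1 + (a + sizeᵛ e x)) (sum-replicate-zero n) ⟩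
    1 + sizeᵛ e x                       ∎
    where
    beyond : Fin n → ℕ
    beyond z = when (z ∈? edge e) (when (¬? (z ≟ᶠ w)) (sizeᵛ e z))
    beyond-x : beyond x ≡₃ 0 + sizeᵛ e x
    beyond-x = ≡⇒≡₃ (trans (when-yes (x ∈? edge e) x∈e _) (when-yes (¬? (x ≟ᶠ w)) x≢w _))
    vanish′ : ∀ z → z ≢ x → beyond z ≡₃ 0
    vanish′ z z≢x = when≡₃0 (z ∈? edge e) λ z∈e → when≡₃0 (¬? (z ≟ᶠ w)) λ z≢w → vanish z z∈e z≢w z≢x

  m≡₃degree : ∀ {w} → (∀ {e x} → w ∈ edge e → x ∈ edge e → x ≢ w → sizeᵛ e x ≡₃ 0) → m ≡₃ d T w
  m≡₃degree {w} vanish = begin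
    m                                              ≡⟨ edges-around-vertex w ⟩
    ∑[ e < m ] when (w ∈? edge e) (sizeᵉ w e)      ≈⟨ sum-cong₃ (λ e → when-cong₃ (w ∈? edge e) sizeᵉ≡₃1′) ⟩
    ∑[ e < m ] 𝟙 (w ∈? edge e)                     ≡⟨ degree-sum w ⟨
    d T w                                          ∎
    where
    sizeᵉ≡₃1′ : ∀ {e} → w ∈ edge e → sizeᵉ w e ≡₃ 1
    sizeᵉ≡₃1′ w∈e = sizeᵉ≡₃1 w∈e λ x x∈e x≢w → vanish w∈e x∈e x≢w

  m≡₃degree+ : ∀ {w e s} → w ∈ edge e → sizeᵉ w e ≡₃ 1 + s → (∀ e′ → e′ ≢ e → w ∈ edge e′ → sizeᵉ w e′ ≡₃ 1) →
               m ≡₃ d T w + s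
  m≡₃degree+ {w} {e} {s} w∈e size-e sizes = begin
    m                                              ≡⟨ edges-around-vertex w ⟩
    ∑[ e′ < m ] when (w ∈? edge e′) (sizeᵉ w e′)   ≈⟨ sum-cong₃-except e size-e′ sizes′ ⟩
    ∑[ e′ < m ] 𝟙 (w ∈? edge e′) + s               ≡⟨ cong (_+ s) (degree-sum w) ⟨
    d T w + s                                      ∎
    where
    size-e′ : when (w ∈? edge e) (sizeᵉ w e) ≡₃ 𝟙 (w ∈? edge e) + s
    size-e′ rewrite when-yes (w ∈? edge e) w∈e (sizeᵉ w e) | when-yes (w ∈? edge e) w∈e 1 = size-e
    sizes′ : ∀ e′ → e′ ≢ e → when (w ∈? edge e′) (sizeᵉ w e′) ≡₃ 𝟙 (w ∈? edge e′)
    sizes′ e′ e′≢e = when-cong₃ (w ∈? edge e′) (sizes e′ e′≢e)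

  degree≡₃+1 : ∀ {x f} → x ∈ edge f → d T x ≡₃ ∑[ e < m ] when (x ∈? edge e) (𝟙 (¬? (e ≟ᶠ f))) + 1
  degree≡₃+1 {x} {f} x∈f = begin
    d T x                         ≡⟨ degree-sum x ⟩
    ∑[ e < m ] 𝟙 (x ∈? edge e)    ≈⟨ sum-cong₃-except f at-f elsewhere ⟩
    ∑[ e < m ] when (x ∈? edge e) (𝟙 (¬? (e ≟ᶠ f))) + 1 ∎
    where
    at-f : 𝟙 (x ∈? edge f) ≡₃ when (x ∈? edge f) (𝟙 (¬? (f ≟ᶠ f))) + 1
    at-f rewrite when-yes (x ∈? edge f) x∈f 1 | when-yes (x ∈? edge f) x∈f (𝟙 (¬? (f ≟ᶠ f)))
               | when-no (¬? (f ≟ᶠ f)) (λ f≢f → f≢f refl) 1 = ≡₃-refl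
    elsewhere : ∀ e → e ≢ f → 𝟙 (x ∈? edge e) ≡₃ when (x ∈? edge e) (𝟙 (¬? (e ≟ᶠ f)))
    elsewhere e e≢f = ≡⇒≡₃ (when-cong (x ∈? edge e) λ _ → sym (when-yes (¬? (e ≟ᶠ f)) e≢f 1))

  sizeᵛ≡₃degree+2 : ∀ {x f} → x ∈ edge f → (∀ e → x ∈ edge e → e ≢ f → sizeᵉ x e ≡₃ 1) → sizeᵛ f x ≡₃ d T x + 2
  sizeᵛ≡₃degree+2 {x} {f} x∈f sizes = begin
    sizeᵛ f x                                                    ≡⟨ sizeᵛ-rec x∈f ⟩
    ∑[ e < m ] when (x ∈? edge e) (when (¬? (e ≟ᶠ f)) (sizeᵉ x e)) ≈⟨ sum-cong₃ sizes′ ⟩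
    others                                                       ≈⟨ mod₃ ([m+n]%n≡m%n others 3) ⟨
    others + 3                                                   ≡⟨ +-assoc others 1 2 ⟨
    others + 1 + 2                                               ≈⟨ +-cong₃ (≡₃-sym (degree≡₃+1 x∈f)) ≡₃-refl ⟩
    d T x + 2                                                    ∎
    where
    others : ℕ
    others = ∑[ e < m ] when (x ∈? edge e) (𝟙 (¬? (e ≟ᶠ f)))
    sizes′ : ∀ e → when (x ∈? edge e) (when (¬? (e ≟ᶠ f)) (sizeᵉ x e)) ≡₃ when (x ∈? edge e) (𝟙 (¬? (e ≟ᶠ f)))
    sizes′ e = when-cong₃ (x ∈? edge e) λ x∈e → when-cong₃ (¬? (e ≟ᶠ f)) λ e≢f → sizes e x∈e e≢f

  HelpfulBranch : Fin n → Fin m → Fin n → Set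
  HelpfulBranch w e x = d T w ≡₃ 2 × w ∈ edge e × x ∈ edge e × x ≢ w × sizeᵛ e x ≡₃ 1

  Witness : Set
  Witness = (∃ λ w → d T w ≡₃ 0) ⊎ (∃ λ w → ∃ λ e → ∃ λ x → HelpfulBranch w e x)

  private
    _≡₃?_ : ∀ a b → Dec (a ≡₃ b)
    a ≡₃? b with a % 3 ≟ℕ b % 3
    ... | yes eq = yes (mod₃ eq)
    ... | no neq = no (neq ∘ %3≡)

  witness? : Dec Witness
  witness? = any? (λ w → d T w ≡₃? 0) ⊎-dec any? λ w → any? λ e → any? λ x →
    (d T w ≡₃? 2) ×-dec ((w ∈? edge e) ×-dec ((x ∈? edge e) ×-dec (¬? (x ≟ᶠ w) ×-dec (sizeᵛ e x ≡₃? 1))))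

  module _ (m≡₃0 : m ≡₃ 0) (no-witness : ¬ Witness) where

    degree≡₃1or2 : ∀ y → d T y ≡₃ 1 ⊎ d T y ≡₃ 2
    degree≡₃1or2 y with residue (d T y)
    ... | inj₁ dy≡0 = ⊥-elim (no-witness (inj₁ (y , dy≡0)))
    ... | inj₂ dy≡1or2 = dy≡1or2

    beside-degree2 : ∀ {w e x} → d T w ≡₃ 2 → w ∈ edge e → x ∈ edge e → x ≢ w →
                     sizeᵛ e x ≡₃ d T x + 2 → sizeᵛ e x ≡₃ 0
    beside-degree2 {w} {e} {x} dw≡2 w∈e x∈e x≢w size≡ with degree≡₃1or2 x
    ... | inj₁ dx≡1 = ≡₃-trans (≡₃-trans size≡ (+-cong₃ dx≡1 ≡₃-refl)) (mod₃ refl)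
    ... | inj₂ dx≡2 = ⊥-elim (no-witness (inj₂ (w , e , x , dw≡2 , w∈e , x∈e , x≢w , size≡1)))
      where
      size≡1 : sizeᵛ e x ≡₃ 1
      size≡1 = ≡₃-trans (≡₃-trans size≡ (+-cong₃ dx≡2 ≡₃-refl)) (mod₃ refl)

    private
      sizeᵛ-residue′ : ∀ k {f x} → sizeᵛ f x < k → x ∈ edge f → sizeᵛ f x ≡₃ d T x + 2
      sizeᵛ-residue′ (suc k) {f} {x} (s≤s size≤k) x∈f =
        sizeᵛ≡₃degree+2 x∈f λ e x∈e e≢f → sizeᵉ≡₃1 x∈e λ y y∈e y≢x →
          ≡₃-trans (≡₃-trans (IH (sizeᵛ-child< x∈f x∈e e≢f y∈e y≢x) y∈e)
                             (+-cong₃ (child-degree x∈e e≢f y∈e y≢x) ≡₃-refl))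
                   (mod₃ refl)
        where
        IH : ∀ {e y} → sizeᵛ e y < sizeᵛ f x → y ∈ edge e → sizeᵛ e y ≡₃ d T y + 2
        IH lt = sizeᵛ-residue′ k (≤-trans lt size≤k)

        -- Around y every branch except the one back through x is smaller, hence ≡ 0 by IH.
        not-degree2 : ∀ {e y} → x ∈ edge e → e ≢ f → y ∈ edge e → y ≢ x → ¬ d T y ≡₃ 2
        not-degree2 {e} {y} x∈e e≢f y∈e y≢x dy≡2 = no-witness (inj₂ (y , e , x , dy≡2 , y∈e , x∈e , x≢y ,
            2+s≡₃0⇒s≡₃1 dy≡2 (≡₃-trans (≡₃-sym m≡dy+s) m≡₃0)))
          where
          x≢y : x ≢ y
          x≢y = y≢x ∘ sym
          vanish-at-y : ∀ {e′ z} → y ∈ edge e′ → z ∈ edge e′ → z ≢ y → sizeᵛ e′ z < sizeᵛ f x → sizeᵛ e′ z ≡₃ 0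
          vanish-at-y y∈e′ z∈e′ z≢y lt = beside-degree2 dy≡2 y∈e′ z∈e′ z≢y (IH lt z∈e′)
          m≡dy+s : m ≡₃ d T y + sizeᵛ e x
          m≡dy+s = m≡₃degree+ y∈e
            (sizeᵉ≡₃1+ y∈e x∈e x≢y λ z z∈e z≢y z≢x → vanish-at-y y∈e z∈e z≢y (sizeᵛ-child< x∈f x∈e e≢f z∈e z≢x))
            (λ e′ e′≢e y∈e′ → sizeᵉ≡₃1 y∈e′ λ z z∈e′ z≢y →
               vanish-at-y y∈e′ z∈e′ z≢y (<-trans (sizeᵛ-child< y∈e y∈e′ e′≢e z∈e′ z≢y) (sizeᵛ-child< x∈f x∈e e≢f y∈e y≢x)))

        child-degree : ∀ {e y} → x ∈ edge e → e ≢ f → y ∈ edge e → y ≢ x → d T y ≡₃ 1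
        child-degree x∈e e≢f y∈e y≢x with degree≡₃1or2 _
        ... | inj₁ dy≡1 = dy≡1
        ... | inj₂ dy≡2 = ⊥-elim (not-degree2 x∈e e≢f y∈e y≢x dy≡2)

    sizeᵛ-residue : ∀ {f x} → x ∈ edge f → sizeᵛ f x ≡₃ d T x + 2
    sizeᵛ-residue = sizeᵛ-residue′ _ ≤-refl

    degree≡₃1 : ∀ y → d T y ≡₃ 1
    degree≡₃1 y with degree≡₃1or2 y
    ... | inj₁ dy≡1 = dy≡1
    ... | inj₂ dy≡2 with ≡₃-trans (≡₃-sym m≡₃0)
                           (≡₃-trans (m≡₃degree λ y∈e x∈e x≢y → beside-degree2 dy≡2 y∈e x∈e x≢y (sizeᵛ-residue x∈e)) dy≡2)
    ...   | mod₃ ()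

    sizeᵛ≡₃0 : ∀ {e x} → x ∈ edge e → sizeᵛ e x ≡₃ 0
    sizeᵛ≡₃0 x∈e = ≡₃-trans (≡₃-trans (sizeᵛ-residue x∈e) (+-cong₃ (degree≡₃1 _) ≡₃-refl)) (mod₃ refl)

    impossible : Fin n → ⊥
    impossible w with ≡₃-trans (≡₃-sym m≡₃0) (≡₃-trans (m≡₃degree λ _ x∈e _ → sizeᵛ≡₃0 x∈e) (degree≡₃1 w))
    ... | mod₃ ()

  witness-exists : m ≡₃ 0 → Witness
  witness-exists m≡₃0 with witness?
  ... | yes w = w
  ... | no ¬w = ⊥-elim (impossible m≡₃0 ¬w (fromℕ< (proj₁ tree)))

module Configuration (T : Hypergraph) (tree : IsHypertree T) where
  open Hypergraph T
  open Incidence T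
  open Branches T tree
  open Residues T tree

  component⇔walk : ∀ {w a c} → SameComponent T w a c ⇔ Walk (Alive T w) a c
  component⇔walk = mk⇔ (gmap id λ { (step p q s) → p , q , s }) (gmap id λ (p , q , s) → step p q s)

  module _ {w e x} (w∈e : w ∈ edge e) (x∈e : x ∈ edge e) (x≢w : x ≢ w) where

    branch-alive : ∀ c → Branch (inj₂ e) (inj₁ x) c → Alive T w c
    branch-alive (inj₁ v) b refl = branches-disjoint (ev x∈e) (ev w∈e) (x≢w ∘ Sum.inj₁-injective) b
    branch-alive (inj₂ g) b w∈g with target-inside b
    ... | inj₂ g≢e = branches-disjoint (ev x∈e) (ev w∈e) (x≢w ∘ Sum.inj₁-injective) (b ◅◅ ((g≢e , (λ ()) , ev w∈g) ◅ ε))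

    alive⇒≢e : ∀ {z} → Alive T w z → z ≢ inj₂ e
    alive⇒≢e {inj₂ _} w∉e refl = w∉e w∈e

    component⇔branch : ∀ {u} → Branch (inj₂ e) (inj₁ x) (inj₁ u) → ∀ c →
                       SameComponent T w (inj₁ u) c ⇔ Branch (inj₂ e) (inj₁ x) c
    component⇔branch x⇝u c = mk⇔
      (λ sc → walk-mono alive⇒≢e (x⇝u′ ◅◅ Equivalence.to component⇔walk sc))
      (λ b → Equivalence.from component⇔walk (reverse x⇝u′ ◅◅ restrict branch-alive b))
      where
      x⇝u′ : Walk (Alive T w) (inj₁ x) (inj₁ _)
      x⇝u′ = restrict branch-alive x⇝u

    not-adjacent : ∀ {u} → Branch (inj₂ e) (inj₁ x) (inj₁ u) → u ≢ x → ¬ Adjacent T u w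
    not-adjacent x⇝u u≢x (g , u∈g , w∈g) with g ≟ᶠ e
    ... | yes refl = branches-disjoint (ev x∈e) (ev u∈g) (u≢x ∘ sym ∘ Sum.inj₁-injective) x⇝u
    ... | no g≢e = branch-alive (inj₂ g) (x⇝u ◅◅ (((λ ()) , g≢e ∘ Sum.inj₂-injective , ve u∈g) ◅ ε)) w∈g

    outside? : ∀ g → Dec (w ∉ edge g × ¬ Branch (inj₂ e) (inj₁ x) (inj₂ g))
    outside? g = ¬? (w ∈? edge g) ×-dec ¬? (branch? (inj₂ e) (inj₁ x) (inj₂ g))

    edges-split : m ≡ d T w + (∣ subsetOf outside? ∣ + sizeᵛ e x)
    edges-split = begin
      m                                                                   ≡⟨ sum-ones m ⟨
      ∑[ g < m ] 1                                                        ≡⟨ sum-cong-≗ trichotomy ⟩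
      ∑[ g < m ] (𝟙 (w ∈? edge g) + (𝟙 (outside? g) + 𝟙 (beyond? g)))   ≡⟨ ∑-distrib-+ (𝟙 ∘ (λ g → w ∈? edge g)) _ ⟩
      ∑[ g < m ] 𝟙 (w ∈? edge g) + ∑[ g < m ] (𝟙 (outside? g) + 𝟙 (beyond? g))
                                  ≡⟨ cong₂ _+_ (sym (degree-sum w)) (∑-distrib-+ (𝟙 ∘ outside?) (𝟙 ∘ beyond?)) ⟩
      d T w + (sum (𝟙 ∘ outside?) + sizeᵛ e x)
                                  ≡⟨ cong (λ p → d T w + (p + sizeᵛ e x)) (∣subsetOf∣ outside?) ⟨
      d T w + (∣ subsetOf outside? ∣ + sizeᵛ e x)                         ∎
      where
      open ≡-Reasoning
      beyond? : ∀ g → Dec (Branch (inj₂ e) (inj₁ x) (inj₂ g))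
      beyond? g = branch? (inj₂ e) (inj₁ x) (inj₂ g)
      trichotomy : ∀ g → 1 ≡ 𝟙 (w ∈? edge g) + (𝟙 (outside? g) + 𝟙 (beyond? g))
      trichotomy g with w ∈? edge g | beyond? g
      ... | yes w∈g | yes b = ⊥-elim (branch-alive (inj₂ g) b w∈g)
      ... | yes _ | no _ = refl
      ... | no _ | yes _ = refl
      ... | no _ | no _ = refl

  helpful-configuration : m ≡₃ 0 → Witness → HasHelpfulConfiguration T
  helpful-configuration _ (inj₁ (w , dw≡0)) = inj₁ (w , %3≡ dw≡0)
  helpful-configuration m≡0 (inj₂ (w , e , x , dw≡2 , w∈e , x∈e , x≢w , s≡1)) with leaf-beyond x∈e (≡₃1⇒>0 s≡1)
  ... | u , u-leaf , x⇝u , u≢x =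
    inj₂ (u , w , (not-adjacent w∈e x∈e x≢w x⇝u u≢x , %3≡ dw≡2 , u-leaf) , P , P-spec , %3≡ ∣P∣≡₃0)
    where
    P : Subset m
    P = subsetOf (outside? w∈e x∈e x≢w)
    P-spec : ∀ g → g ∈ P ⇔ InP T u w g
    P-spec g = mk⇔
      (λ g∈P → let w∉g , x⇝̸g = Equivalence.to (∈-subsetOf (outside? w∈e x∈e x≢w) g) g∈P
               in w∉g , x⇝̸g ∘ Equivalence.to (component⇔branch w∈e x∈e x≢w x⇝u (inj₂ g)))
      (λ (w∉g , u⇝̸g) → Equivalence.from (∈-subsetOf (outside? w∈e x∈e x≢w) g)
               (w∉g , u⇝̸g ∘ Equivalence.from (component⇔branch w∈e x∈e x≢w x⇝u (inj₂ g))))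
    ∣P∣+s≡₃1 : ∣ P ∣ + sizeᵛ e x ≡₃ 1
    ∣P∣+s≡₃1 = 2+s≡₃0⇒s≡₃1 dw≡2 (≡₃-trans (≡₃-sym (≡⇒≡₃ (edges-split w∈e x∈e x≢w))) m≡0)
    ∣P∣≡₃0 : ∣ P ∣ ≡₃ 0
    ∣P∣≡₃0 = +-cancelˡ₃ 1 (≡₃-trans (≡⇒≡₃ (+-comm 1 ∣ P ∣)) (≡₃-trans (+-cong₃ ≡₃-refl (≡₃-sym s≡1)) ∣P∣+s≡₃1))

lemma5 : (T : Hypergraph) → IsHypertree T → Hypergraph.m T % 3 ≡ 0 → HasHelpfulConfiguration T
lemma5 T tree m%3≡0 = helpful-configuration m≡₃0 (witness-exists m≡₃0)
  where
  open Configuration T tree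
  open Residues T tree
  m≡₃0 : Hypergraph.m T ≡₃ 0
  m≡₃0 = mod₃ m%3≡0
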